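{- Let $G$ be a finite simple graph, $\Lambda\subseteq\Omega(G)$, $|\Lambda|\ge 1$. (i) If $\bigcup\Lambda$ is critical, then $\left|N\left(\bigcap\Lambda\right)\right|+\left|\bigcup\Lambda\right|=|V(G)|$, and $\bigcap\Lambda$ is critical. (ii) If $\bigcap\Lambda$ is critical, then $\left|N\left(\bigcap\Lambda\right)\right|+\left|\bigcup\Lambda\right|\le |V(G)|$ and $d\left(\bigcap\Lambda\right)\ge 2\alpha(G)-|V(G)|$.
   Context: For $X\subseteq V(G)$, $N(X)$ is the set of vertices adjacent to some vertex of $X$, $d(X)=|X|-|N(X)|$, $d(G)=\max\{d(X):X\subseteq V(G)\}$, and $X$ is critical if $d(X)=d(G)$. $\alpha(G)$ is the maximum cardinality of an independent set and $\Omega(G)$ is the family of all maximum independent sets. $\bigcup\Lambda,\bigcap\Lambda$ denote union and intersection of the members of $\Lambda$. -}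

module Defs where

open import Data.Bool using (Bool; true; false; _∧_; _∨_; not; if_then_else_)
open import Data.Product using (_×_)
open import Data.Nat as ℕ using (ℕ; zero; suc)
open import Data.Integer as ℤ using (ℤ; +_; _-_)
open import Data.Fin using (Fin)
open import Data.Fin.Subset using (Subset; _∈_; ∣_∣; ⊥)
open import Data.Vec using (Vec; []; _∷_; tabulate; lookup)
open import Data.List using (List; []; _∷_; map; foldr; _++_)
open import Relation.Binary.PropositionalEquality using (_≡_)

record Graph (n : ℕ) : Set where
  field
    adj   : Fin n → Fin n → Bool
    sym   : ∀ u v → adj u v ≡ adj v u
    irrefl : ∀ v → adj v v ≡ false
open Graph public

anyFin : ∀ {n} → (Fin n → Bool) → Bool
anyFin {zero}  f = false
anyFin {suc n} f = f Fin.zero ∨ anyFin (λ i → f (Fin.suc i))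
  where import Data.Fin as Fin

allSubsets : ∀ n → List (Subset n)
allSubsets zero    = [] ∷ []
allSubsets (suc n) = map (true ∷_) (allSubsets n) ++ map (false ∷_) (allSubsets n)

module _ {n : ℕ} (G : Graph n) where

  N : Subset n → Subset n
  N X = tabulate (λ v → anyFin (λ u → lookup X u ∧ adj G u v))

  d : Subset n → ℤ
  d X = + ∣ X ∣ - + ∣ N X ∣

  -- d(G) = max { d(X) : X ⊆ V(G) }   (d(∅) = 0 is the fold's start value, also attained)
  dG : ℤ
  dG = foldr (λ X m → d X ℤ.⊔ m) (d ⊥) (allSubsets n)

  Critical : Subset n → Set
  Critical X = d X ≡ dG

  Independent : Subset n → Set
  Independent S = ∀ u v → u ∈ S → v ∈ S → adj G u v ≡ false

  independentᵇ : Subset n → Bool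
  independentᵇ S = not (anyFin (λ u → anyFin (λ v → lookup S u ∧ lookup S v ∧ adj G u v)))

  α : ℕ
  α = foldr (λ S m → (if independentᵇ S then ∣ S ∣ else 0) ℕ.⊔ m) 0 (allSubsets n)

  InΩ : Subset n → Set
  InΩ S = Independent S × ∣ S ∣ ≡ α

-- Write I = ⋂Λ and U = ⋃Λ. Any two vertices of I ∪ U lie in a common member of Λ, so
-- there are no edges between I and U, and N(I) ⊆ V ∖ U, N(U) ⊆ V ∖ I. A maximum independent
-- set dominates every vertex outside it, and a vertex outside I lies outside some member of
-- Λ, so in fact N(U) = V ∖ I. Hence d(I) − d(U) = |V| − (|N(I)| + |U|) ≥ 0: if U is critical
-- this gap vanishes, and if I is critical then d(I) ≥ d(S) = 2α − |V| for any S ∈ Λ.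
module Submission where

open import Defs
open import Data.Nat using (ℕ; _+_; _*_; _≤_)
open import Data.Integer as ℤ using (+_; _-_)
open import Data.Fin.Subset using (Subset; ∣_∣; ⋃; ⋂)
open import Data.List.NonEmpty using (List⁺; toList)
open import Data.List.Relation.Unary.All using (All)
open import Data.Product using (_×_)
open import Relation.Binary.PropositionalEquality using (_≡_)

open import Algebra.Bundles using (AbelianGroup)
open import Data.Bool using (Bool; true; false; _∧_; not; if_then_else_)
open import Data.Bool.Properties using (¬-not; not-¬; ∨-zeroʳ)
open import Data.Fin using (Fin)
open import Data.Fin.Subset using (_∪_; _∈_; _∉_; _⊆_; ∁; ⁅_⁆; ⊥)
open import Data.Empty using (⊥-elim)
open import Data.Fin.Subset.Properties
open import Data.Integer.Properties as ℤ using (pos-+; pos-*)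
open import Data.Integer.Tactic.RingSolver using (solve-∀)
open import Data.List using (List; []; _∷_; foldr; map)
open import Data.List.Membership.Propositional using (find) renaming (_∈_ to _∈ₗ_)
open import Data.List.Membership.Propositional.Properties using (∈-map⁺; ∈-++⁺ˡ; ∈-++⁺ʳ)
open import Data.List.NonEmpty using (_∷_)
open import Data.List.Relation.Unary.Any using (Any; here; there)
import Data.List.Relation.Unary.All as All
open import Data.List.Relation.Unary.All.Properties using (¬All⇒Any¬)
open import Data.Nat as ℕ using (_∸_)
open import Data.Nat.Properties as ℕ using (m+[n∸m]≡n; m∸n+n≡m; m∸n≡0⇒m≤n)
open import Data.Product using (∃-syntax; _,_; proj₁)
open import Data.Sum using (inj₁; inj₂)
open import Data.Vec using ([]; _∷_)
open import Data.Vec.Properties using (lookup∘tabulate; lookup⇒[]=; []=⇒lookup)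
open import Function using (_∘_)
open import Relation.Binary.PropositionalEquality
  using (refl; trans; cong; cong₂; subst; subst₂; module ≡-Reasoning)
  renaming (sym to ≡-sym)
open import Relation.Nullary using (yes; no)

open import Algebra.Properties.Group (AbelianGroup.group ℤ.+-0-abelianGroup)
  using (identityʳ-unique)

∧≡true⁻ : ∀ {a b} → a ∧ b ≡ true → a ≡ true × b ≡ true
∧≡true⁻ {true} {true} _ = refl , refl

∧≡false⁺ : ∀ {a b} → (a ≡ true → b ≡ false) → a ∧ b ≡ false
∧≡false⁺ {true}  h = h refl
∧≡false⁺ {false} h = refl

anyFin⁻ : ∀ {n} (f : Fin n → Bool) → anyFin f ≡ true → ∃[ i ] f i ≡ true
anyFin⁻ {ℕ.suc n} f e with f Fin.zero in f0
... | true  = Fin.zero , f0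
... | false = let i , fi = anyFin⁻ (f ∘ Fin.suc) e in Fin.suc i , fi

anyFin⁺ : ∀ {n} (f : Fin n → Bool) i → f i ≡ true → anyFin f ≡ true
anyFin⁺ f Fin.zero    fi rewrite fi = refl
anyFin⁺ f (Fin.suc i) fi rewrite anyFin⁺ (f ∘ Fin.suc) i fi = ∨-zeroʳ (f Fin.zero)

anyFin-false : ∀ {n} (f : Fin n → Bool) → (∀ i → f i ≡ false) → anyFin f ≡ false
anyFin-false f h = ¬-not λ e → let i , fi = anyFin⁻ f e in not-¬ fi (h i)

module _ {n : ℕ} {x : Fin n} where

  ∈⋃⁻ : ∀ L → x ∈ ⋃ L → Any (x ∈_) L
  ∈⋃⁻ []      x∈ = ⊥-elim (∉⊥ x∈)
  ∈⋃⁻ (S ∷ L) x∈ with x∈p∪q⁻ S (⋃ L) x∈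
  ... | inj₁ x∈S = here x∈S
  ... | inj₂ x∈⋃ = there (∈⋃⁻ L x∈⋃)

  ∈⋂⁻ : ∀ L → x ∈ ⋂ L → All (x ∈_) L
  ∈⋂⁻ []      _  = All.[]
  ∈⋂⁻ (S ∷ L) x∈ = let x∈S , x∈⋂ = x∈p∩q⁻ S (⋂ L) x∈ in x∈S All.∷ ∈⋂⁻ L x∈⋂

  ∈⋂⁺ : ∀ {L} → All (x ∈_) L → x ∈ ⋂ L
  ∈⋂⁺ All.[]         = ∈⊤
  ∈⋂⁺ (x∈S All.∷ x∈) = x∈p∩q⁺ (x∈S , ∈⋂⁺ x∈)

  ∉⋂⁻ : ∀ L → x ∉ ⋂ L → Any (x ∉_) L
  ∉⋂⁻ L x∉ = ¬All⇒Any¬ (x ∈?_) L (x∉ ∘ ∈⋂⁺)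

⊆⋃ : ∀ {n} {S : Subset n} {L} → S ∈ₗ L → S ⊆ ⋃ L
⊆⋃ (here refl) x∈ = x∈p∪q⁺ (inj₁ x∈)
⊆⋃ (there S∈L) x∈ = x∈p∪q⁺ (inj₂ (⊆⋃ S∈L x∈))

∣p∣+∣∁p∣≡n : ∀ {n} (p : Subset n) → ∣ p ∣ + ∣ ∁ p ∣ ≡ n
∣p∣+∣∁p∣≡n p = trans (cong (λ k → ∣ p ∣ + k) (∣∁p∣≡n∸∣p∣ p)) (m+[n∸m]≡n (∣p∣≤n p))

p⊆∁q⇒∣p∣+∣q∣≤n : ∀ {n} {p q : Subset n} → p ⊆ ∁ q → ∣ p ∣ + ∣ q ∣ ≤ n
p⊆∁q⇒∣p∣+∣q∣≤n {n} {p} {q} p⊆∁q = begin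
  ∣ p ∣ + ∣ q ∣         ≤⟨ ℕ.+-monoˡ-≤ ∣ q ∣ (subst (∣ p ∣ ≤_) (∣∁p∣≡n∸∣p∣ q) (p⊆q⇒∣p∣≤∣q∣ p⊆∁q)) ⟩
  (n ∸ ∣ q ∣) + ∣ q ∣   ≡⟨ m∸n+n≡m (∣p∣≤n q) ⟩
  n                     ∎
  where open ℕ.≤-Reasoning

∈-allSubsets : ∀ {n} (X : Subset n) → X ∈ₗ allSubsets n
∈-allSubsets []          = here refl
∈-allSubsets (true ∷ X)  = ∈-++⁺ˡ (∈-map⁺ (true ∷_) (∈-allSubsets X))
∈-allSubsets {ℕ.suc n} (false ∷ X) =
  ∈-++⁺ʳ (map (true ∷_) (allSubsets n)) (∈-map⁺ (false ∷_) (∈-allSubsets X))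

module _ {A : Set} (f : A → ℕ) (z : ℕ) where

  ≤-foldr-⊔ : ∀ {X L} → X ∈ₗ L → f X ≤ foldr (λ Y m → f Y ℕ.⊔ m) z L
  ≤-foldr-⊔ (here refl) = ℕ.m≤m⊔n (f _) _
  ≤-foldr-⊔ {L = Y ∷ _} (there X∈L) = ℕ.≤-trans (≤-foldr-⊔ X∈L) (ℕ.m≤n⊔m (f Y) _)

module _ {A : Set} (f : A → ℤ.ℤ) (z : ℤ.ℤ) where

  ≤-foldr-⊔ℤ : ∀ {X L} → X ∈ₗ L → f X ℤ.≤ foldr (λ Y m → f Y ℤ.⊔ m) z L
  ≤-foldr-⊔ℤ (here refl) = ℤ.i≤i⊔j (f _) _
  ≤-foldr-⊔ℤ {L = Y ∷ _} (there X∈L) = ℤ.≤-trans (≤-foldr-⊔ℤ X∈L) (ℤ.i≤j⊔i (f Y) _)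

x-y≡z-w+t : ∀ x y z w t → x ℤ.+ w ≡ y ℤ.+ z ℤ.+ t → x - y ≡ (z - w) ℤ.+ t
x-y≡z-w+t x y z w t x+w≡y+z+t = begin
  x - y                                                    ≡⟨ regroup x y z w t ⟩
  ((x ℤ.+ w) - (y ℤ.+ z ℤ.+ t)) ℤ.+ ((z - w) ℤ.+ t)        ≡⟨ cong (λ s → (s - (y ℤ.+ z ℤ.+ t)) ℤ.+ ((z - w) ℤ.+ t)) x+w≡y+z+t ⟩
  ((y ℤ.+ z ℤ.+ t) - (y ℤ.+ z ℤ.+ t)) ℤ.+ ((z - w) ℤ.+ t)  ≡⟨ cong (ℤ._+ ((z - w) ℤ.+ t)) (ℤ.+-inverseʳ (y ℤ.+ z ℤ.+ t)) ⟩
  ℤ.0ℤ ℤ.+ ((z - w) ℤ.+ t)                                ≡⟨ ℤ.+-identityˡ _ ⟩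
  (z - w) ℤ.+ t                                            ∎
  where
  open ≡-Reasoning
  regroup : ∀ x y z w t → x - y ≡ ((x ℤ.+ w) - (y ℤ.+ z ℤ.+ t)) ℤ.+ ((z - w) ℤ.+ t)
  regroup = solve-∀

a-b≡c-e+gap : ∀ {a b c e n} → a + e ≡ n → b + c ≤ n → + a - + b ≡ (+ c - + e) ℤ.+ + (n ∸ (b + c))
a-b≡c-e+gap {a} {b} {c} {e} {n} a+e≡n b+c≤n =
  x-y≡z-w+t (+ a) (+ b) (+ c) (+ e) (+ (n ∸ (b + c))) (begin
  + a ℤ.+ + e                   ≡⟨ ≡-sym (pos-+ a e) ⟩
  + (a + e)                     ≡⟨ cong +_ (trans a+e≡n (≡-sym (m+[n∸m]≡n b+c≤n))) ⟩
  + (b + c + (n ∸ (b + c)))     ≡⟨ pos-+ (b + c) _ ⟩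
  + (b + c) ℤ.+ + (n ∸ (b + c)) ≡⟨ cong (ℤ._+ + (n ∸ (b + c))) (pos-+ b c) ⟩
  + b ℤ.+ + c ℤ.+ + (n ∸ (b + c)) ∎)
  where open ≡-Reasoning

a-b≡2a-[a+b] : ∀ {a b k} → a + b ≡ k → + a - + b ≡ + (2 * a) - + k
a-b≡2a-[a+b] {a} {b} refl = begin
  + a - + b                     ≡⟨ x-y≡2x-[x+y] (+ a) (+ b) ⟩
  ℤ.+ 2 ℤ.* + a - (+ a ℤ.+ + b) ≡⟨ ≡-sym (cong₂ _-_ (pos-* 2 a) (pos-+ a b)) ⟩
  + (2 * a) - + (a + b)         ∎
  where
  open ≡-Reasoning
  x-y≡2x-[x+y] : ∀ x y → x - y ≡ ℤ.+ 2 ℤ.* x - (x ℤ.+ y)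
  x-y≡2x-[x+y] = solve-∀

i+k≤i⇒k≡0 : ∀ i k → i ℤ.+ + k ℤ.≤ i → k ≡ 0
i+k≤i⇒k≡0 i k i+k≤i =
  ℤ.+-injective (identityʳ-unique i (+ k) (ℤ.≤-antisym i+k≤i (ℤ.i≤i+j i (+ k))))

module _ {n : ℕ} (G : Graph n) where

  ∈N⁻ : ∀ {X v} → v ∈ N G X → ∃[ u ] u ∈ X × adj G u v ≡ true
  ∈N⁻ {X} {v} v∈NX =
    let u , e = anyFin⁻ _ (trans (≡-sym (lookup∘tabulate _ v)) ([]=⇒lookup v∈NX))
        u∈X , uv = ∧≡true⁻ e
    in u , lookup⇒[]= u X u∈X , uv

  ∈N⁺ : ∀ {X u v} → u ∈ X → adj G u v ≡ true → v ∈ N G X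
  ∈N⁺ {X} {u} {v} u∈X uv = lookup⇒[]= v (N G X)
    (trans (lookup∘tabulate _ v) (anyFin⁺ _ u (cong₂ _∧_ ([]=⇒lookup u∈X) uv)))

  N-mono : ∀ {X Y} → X ⊆ Y → N G X ⊆ N G Y
  N-mono X⊆Y v∈NX = let u , u∈X , uv = ∈N⁻ v∈NX in ∈N⁺ (X⊆Y u∈X) uv

  N⊆∁ : ∀ {X Y} → (∀ {u v} → u ∈ X → v ∈ Y → adj G u v ≡ false) → N G X ⊆ ∁ Y
  N⊆∁ noEdge v∈NX = x∉p⇒x∈∁p λ v∈Y →
    let u , u∈X , uv = ∈N⁻ v∈NX in not-¬ uv (noEdge u∈X v∈Y)

  d≤dG : ∀ X → d G X ℤ.≤ dG G
  d≤dG X = ≤-foldr-⊔ℤ (d G) (d G ⊥) (∈-allSubsets X)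

  independentᵇ-complete : ∀ {S} → Independent G S → independentᵇ G S ≡ true
  independentᵇ-complete {S} indep = cong not (anyFin-false _ λ u → anyFin-false _ λ v →
    ∧≡false⁺ λ u∈S → ∧≡false⁺ λ v∈S → indep u v (lookup⇒[]= u S u∈S) (lookup⇒[]= v S v∈S))

  ∣independent∣≤α : ∀ {S} → Independent G S → ∣ S ∣ ≤ α G
  ∣independent∣≤α {S} indep = subst (_≤ α G)
    (cong (if_then ∣ S ∣ else 0) (independentᵇ-complete indep))
    (≤-foldr-⊔ (λ T → if independentᵇ G T then ∣ T ∣ else 0) 0 (∈-allSubsets S))

  ∪⁅⁆-independent : ∀ {S v} → Independent G S → v ∉ N G S → Independent G (S ∪ ⁅ v ⁆)
  ∪⁅⁆-independent {S} {v} indep v∉NS u w u∈ w∈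
    with x∈p∪q⁻ S ⁅ v ⁆ u∈ | x∈p∪q⁻ S ⁅ v ⁆ w∈
  ... | inj₁ u∈S | inj₁ w∈S = indep u w u∈S w∈S
  ... | inj₁ u∈S | inj₂ w∈v rewrite x∈⁅y⁆⇒x≡y v w∈v = ¬-not (v∉NS ∘ ∈N⁺ u∈S)
  ... | inj₂ u∈v | inj₁ w∈S rewrite x∈⁅y⁆⇒x≡y v u∈v =
    trans (Graph.sym G v w) (¬-not (v∉NS ∘ ∈N⁺ w∈S))
  ... | inj₂ u∈v | inj₂ w∈v rewrite x∈⁅y⁆⇒x≡y v u∈v | x∈⁅y⁆⇒x≡y v w∈v = irrefl G v

  -- Otherwise S ∪ ⁅ v ⁆ would be a strictly larger independent set.
  maximum⇒dominating : ∀ {S v} → InΩ G S → v ∉ S → v ∈ N G S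
  maximum⇒dominating {S} {v} (indep , ∣S∣≡α) v∉S with v ∈? N G S
  ... | yes v∈NS = v∈NS
  ... | no  v∉NS = ⊥-elim (ℕ.<-irrefl ∣S∣≡α (ℕ.<-≤-trans ∣S∣<∣S∪v∣
                     (∣independent∣≤α (∪⁅⁆-independent indep v∉NS))))
    where
    ∣S∣<∣S∪v∣ : ∣ S ∣ ℕ.< ∣ S ∪ ⁅ v ⁆ ∣
    ∣S∣<∣S∪v∣ = p⊂q⇒∣p∣<∣q∣ (p⊆p∪q ⁅ v ⁆ , v , x∈p∪q⁺ (inj₂ (x∈⁅x⁆ v)) , v∉S)

  N≡∁ : ∀ {S} → InΩ G S → N G S ≡ ∁ S
  N≡∁ Ω@(indep , _) =
    ⊆-antisym (N⊆∁ (indep _ _)) (maximum⇒dominating Ω ∘ x∈∁p⇒x∉p)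

  d≡2α-n : ∀ {S} → InΩ G S → d G S ≡ + (2 * α G) - + n
  d≡2α-n {S} Ω@(_ , ∣S∣≡α) = trans
    (a-b≡2a-[a+b] {∣ S ∣} {∣ N G S ∣} (subst (λ T → ∣ S ∣ + ∣ T ∣ ≡ n) (≡-sym (N≡∁ Ω)) (∣p∣+∣∁p∣≡n S)))
    (cong (λ a → + (2 * a) - + n) ∣S∣≡α)

  module _ {L : List (Subset n)} (Ω : All (InΩ G) L) where

    no-edge-⋂-⋃ : ∀ {u v} → u ∈ ⋂ L → v ∈ ⋃ L → adj G u v ≡ false
    no-edge-⋂-⋃ {u} {v} u∈⋂ v∈⋃ =
      let S , S∈L , v∈S = find (∈⋃⁻ L v∈⋃)
      in proj₁ (All.lookup Ω S∈L) u v (All.lookup (∈⋂⁻ L u∈⋂) S∈L) v∈S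

    N⋂⊆∁⋃ : N G (⋂ L) ⊆ ∁ (⋃ L)
    N⋂⊆∁⋃ = N⊆∁ no-edge-⋂-⋃

    N⋃≡∁⋂ : N G (⋃ L) ≡ ∁ (⋂ L)
    N⋃≡∁⋂ = ⊆-antisym
      (N⊆∁ λ {u} {v} u∈⋃ v∈⋂ → trans (Graph.sym G u v) (no-edge-⋂-⋃ v∈⋂ u∈⋃))
      λ v∈∁⋂ → let S , S∈L , v∉S = find (∉⋂⁻ L (x∈∁p⇒x∉p v∈∁⋂))
               in N-mono (⊆⋃ S∈L) (maximum⇒dominating (All.lookup Ω S∈L) v∉S)

    ∣N⋂∣+∣⋃∣≤n : ∣ N G (⋂ L) ∣ + ∣ ⋃ L ∣ ≤ n
    ∣N⋂∣+∣⋃∣≤n = p⊆∁q⇒∣p∣+∣q∣≤n N⋂⊆∁⋃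

    d⋂≡d⋃+gap : d G (⋂ L) ≡ d G (⋃ L) ℤ.+ + (n ∸ (∣ N G (⋂ L) ∣ + ∣ ⋃ L ∣))
    d⋂≡d⋃+gap = a-b≡c-e+gap {∣ ⋂ L ∣} {∣ N G (⋂ L) ∣} {∣ ⋃ L ∣} {∣ N G (⋃ L) ∣}
      (subst (λ T → ∣ ⋂ L ∣ + ∣ T ∣ ≡ n) (≡-sym N⋃≡∁⋂) (∣p∣+∣∁p∣≡n (⋂ L)))
      ∣N⋂∣+∣⋃∣≤n

theorem3p3 : ∀ {n : ℕ} (G : Graph n) (Λ : List⁺ (Subset n)) →
    All (InΩ G) (toList Λ) →
    (Critical G (⋃ (toList Λ)) →
        (∣ N G (⋂ (toList Λ)) ∣ + ∣ ⋃ (toList Λ) ∣ ≡ n) × Critical G (⋂ (toList Λ)))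
    × (Critical G (⋂ (toList Λ)) →
        (∣ N G (⋂ (toList Λ)) ∣ + ∣ ⋃ (toList Λ) ∣ ≤ n)
        × (+ (2 * α G) - + n ℤ.≤ d G (⋂ (toList Λ))))
theorem3p3 {n} G Λ@(S ∷ _) Ω = ⋃-critical , ⋂-critical
  where
  I = ⋂ (toList Λ)
  U = ⋃ (toList Λ)
  gap = n ∸ (∣ N G I ∣ + ∣ U ∣)

  ⋃-critical : Critical G U → (∣ N G I ∣ + ∣ U ∣ ≡ n) × Critical G I
  ⋃-critical crit = ℕ.≤-antisym (∣N⋂∣+∣⋃∣≤n G Ω) (m∸n≡0⇒m≤n gap≡0) , trans dI≡dU crit
    where
    gap≡0 : gap ≡ 0
    gap≡0 = i+k≤i⇒k≡0 (d G U) gap (subst₂ ℤ._≤_ (d⋂≡d⋃+gap G Ω) (≡-sym crit) (d≤dG G I))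
    dI≡dU : d G I ≡ d G U
    dI≡dU = trans (d⋂≡d⋃+gap G Ω) (trans (cong (λ k → d G U ℤ.+ + k) gap≡0) (ℤ.+-identityʳ (d G U)))

  ⋂-critical : Critical G I → (∣ N G I ∣ + ∣ U ∣ ≤ n) × (+ (2 * α G) - + n ℤ.≤ d G I)
  ⋂-critical crit =
    ∣N⋂∣+∣⋃∣≤n G Ω , subst₂ ℤ._≤_ (d≡2α-n G (All.lookup Ω (here refl))) (≡-sym crit) (d≤dG G S)
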